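{- Let $\alpha$ be a fixed positive integer. Then for all sufficiently large integers $n$ (in particular with $n > 2\alpha$), \[ l(n) \leq \binom{n}{2} - \alpha . \]
   Context: All graphs are finite and simple. For integers $a\le b$, $[a,b]$ denotes the set of integers $x$ with $a\le x\le b$. A graph $G$ is super edge-magic if there is a bijection $f:V(G)\cup E(G)\to[1,|V(G)|+|E(G)|]$ with $f(V(G))=[1,|V(G)|]$ such that $f(u)+f(v)+f(uv)$ is the same constant for every edge $uv\in E(G)$. The super edge-magic deficiency $\mu_s(G)$ of a graph $G$ is the smallest nonnegative integer $k$ such that the disjoint union $G\cup kK_1$ of $G$ with $k$ isolated vertices is super edge-magic, or $+\infty$ if no such $k$ exists. For a positive integer $n$, $l(n)$ denotes the minimum positive integer such that every graph of order $n$ and size at least $l(n)$ satisfies $\mu_s(G)=+\infty$. -}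

module Defs where

open import Data.Nat using (ℕ; zero; suc; _+_; _≤_)
open import Data.Fin using (Fin; toℕ; _↑ˡ_)
import Data.Fin as F
open import Data.Fin.Properties using (toℕ-↑ˡ; ↑ˡ-injective)
open import Data.Product using (Σ; _×_; _,_; proj₁; proj₂; ∃)
open import Function.Definitions using (Injective; Bijective)
open import Relation.Binary.PropositionalEquality using (_≡_; refl; subst; sym; cong; cong₂)
open import Relation.Nullary using (¬_)

-- A finite simple graph on vertex set Fin n: its edges are indexed by Fin size,
-- each edge is an unordered pair {u,v}, stored normalised as (u , v) with u < v,
-- and distinct indices give distinct edges (no multi-edges; u < v forbids loops).
record Graph (n : ℕ) : Set where
  field
    size  : ℕ
    edge  : Fin size → Fin n × Fin n
    edge< : ∀ e → proj₁ (edge e) F.< proj₂ (edge e)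
    edge-inj : Injective _≡_ _≡_ edge
open Graph public

private
  pair-inj : ∀ {n k} {a b c d : Fin n} →
             (a ↑ˡ k , b ↑ˡ k) ≡ (c ↑ˡ k , d ↑ˡ k) → (a , b) ≡ (c , d)
  pair-inj {n} {k} eq =
    cong₂ _,_ (↑ˡ-injective k _ _ (cong proj₁ eq)) (↑ˡ-injective k _ _ (cong proj₂ eq))

addIsolated : ∀ {n} (k : ℕ) → Graph n → Graph (n + k)
addIsolated {n} k G = record
  { size = size G
  ; edge = λ e → (proj₁ (edge G e) ↑ˡ k , proj₂ (edge G e) ↑ˡ k)
  ; edge< = λ e → subst₂' (toℕ-↑ˡ (proj₁ (edge G e)) k) (toℕ-↑ˡ (proj₂ (edge G e)) k) (edge< G e)
  ; edge-inj = λ eq → edge-inj G (pair-inj eq)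
  }
  where
  subst₂' : ∀ {a b c d : ℕ} → a ≡ c → b ≡ d → suc c ≤ d → suc a ≤ b
  subst₂' refl refl p = p

-- Super edge-magic: a bijection f : V ∪ E → [1, p+q] with f(V) = [1, p]
-- (hence f(E) = [p+1, p+q]) such that f(u)+f(v)+f(uv) is constant over edges.
-- Vertex labels: x ↦ 1 + toℕ (fv x) with fv : Fin p → Fin p bijective;
-- edge labels:   e ↦ p + 1 + toℕ (fe e) with fe : Fin q → Fin q bijective.
SuperEdgeMagic : ∀ {p} → Graph p → Set
SuperEdgeMagic {p} G =
  Σ (Fin p → Fin p) λ fv → Bijective _≡_ _≡_ fv ×
  Σ (Fin (size G) → Fin (size G)) λ fe → Bijective _≡_ _≡_ fe ×
  Σ ℕ λ c → ∀ e →
    suc (toℕ (fv (proj₁ (edge G e)))) + suc (toℕ (fv (proj₂ (edge G e))))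
      + (p + suc (toℕ (fe e))) ≡ c

-- μ_s(G) = +∞ : no G ∪ k K₁ is super edge-magic.
InfiniteDeficiency : ∀ {n} → Graph n → Set
InfiniteDeficiency G = ∀ k → ¬ SuperEdgeMagic (addIsolated k G)

AllInfiniteFrom : ℕ → ℕ → Set
AllInfiniteFrom n l = ∀ (G : Graph n) → l ≤ size G → InfiniteDeficiency G

-- IsL n l : l = l(n), the minimum positive integer with AllInfiniteFrom n l.
IsL : ℕ → ℕ → Set
IsL n l = 1 ≤ l × AllInfiniteFrom n l × (∀ l' → 1 ≤ l' → AllInfiniteFrom n l' → l ≤ l')

-- If G has n vertices and at least C(n,2) − α edges, deleting one endpoint of every non-edge
-- leaves a clique K on m ≥ n − α vertices. A super edge-magic labelling makes the edge sums
-- f(u) + f(v) distinct and confines them to a window of width |E(G)| ≤ C(n,2), so the labels on K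
-- form a Sidon set. A Sidon set of m numbers inside an interval of length D has C(m,2) ≤ D + m,
-- because differences repeat only along three-term progressions. Applied to K and to K without
-- its two extreme labels, the two lengths add up to the difference of two edge sums, whence
-- C(m,2) + C(m−2,2) < C(n,2) + 2m − 2; this is false once m ≥ n − α and n ≥ 5α + 10.
module Submission where

open import Defs
open import Data.Nat using (ℕ; _≤_; _∸_)
open import Data.Nat.Combinatorics using (_C_)
open import Data.Product using (∃)

open import Data.Nat using (zero; suc; _+_; _*_; _<_; _≥_; z≤n; s≤s; _<?_; _≟_)
open import Data.Nat.Properties
open import Data.Nat.Combinatorics using (nCk+nC[k+1]≡[n+1]C[k+1]; nC1≡n)
open import Data.Nat.Tactic.RingSolver using (solve-∀)
open import Data.Fin as F using (Fin; zero; suc; toℕ; fromℕ; fromℕ<; inject₁; splitAt; join; punchIn; punchOut; _↑ˡ_)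
import Data.Fin.Properties as FP
open import Data.Product using (Σ; _×_; _,_; proj₁; proj₂; uncurry)
open import Data.Product.Properties using (≡-dec)
open import Data.Sum using (_⊎_; inj₁; inj₂; [_,_])
open import Data.Empty using (⊥-elim)
open import Function using (_∘_; flip)
open import Function.Definitions using (Injective)
open import Relation.Binary.Definitions using (Reflexive; Transitive; Total; tri<; tri≈; tri>)
open import Relation.Binary.PropositionalEquality hiding ([_])
open import Relation.Nullary using (¬_; Dec; yes; no; ¬?; _×-dec_)
open import Relation.Nullary.Decidable using (decidable-stable)

-- Counting ascending pairs

tri : ℕ → ℕ
tri zero    = 0
tri (suc n) = tri n + n

tri≡nC2 : ∀ n → tri n ≡ n C 2
tri≡nC2 zero    = refl
tri≡nC2 (suc n) = begin
  tri n + n      ≡⟨ cong₂ _+_ (tri≡nC2 n) (sym (nC1≡n n)) ⟩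
  n C 2 + n C 1  ≡⟨ +-comm (n C 2) (n C 1) ⟩
  n C 1 + n C 2  ≡⟨ nCk+nC[k+1]≡[n+1]C[k+1] n 1 ⟩
  suc n C 2      ∎
  where open ≡-Reasoning

tri-mono-≤ : ∀ {m n} → m ≤ n → tri m ≤ tri n
tri-mono-≤ z≤n       = z≤n
tri-mono-≤ (s≤s m≤n) = +-mono-≤ (tri-mono-≤ m≤n) m≤n

tri-double : ∀ n → 2 * tri n + n ≡ n * n
tri-double zero    = refl
tri-double (suc n) = begin
  2 * (tri n + n) + suc n        ≡⟨ regroup (tri n) n ⟩
  (2 * tri n + n) + (2 * n + 1)  ≡⟨ cong (_+ (2 * n + 1)) (tri-double n) ⟩
  n * n + (2 * n + 1)            ≡⟨ square-suc n ⟩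
  suc n * suc n                  ∎
  where
  open ≡-Reasoning
  regroup : ∀ t n → 2 * (t + n) + suc n ≡ (2 * t + n) + (2 * n + 1)
  regroup = solve-∀
  square-suc : ∀ n → n * n + (2 * n + 1) ≡ suc n * suc n
  square-suc = solve-∀

-- Since 2 · tri n + n = n², doubling gives a polynomial inequality; with x = 8 + 4α + δ
-- the gap between its sides is the slack below.
tri-gap : ∀ {α x} → 8 + 4 * α ≤ x → tri (2 + x + α) + (2 + x) + x ≤ tri (2 + x) + tri x
tri-gap {α} {x} x-large with m≤n⇒∃[o]m+o≡n x-large
... | δ , refl = *-cancelˡ-≤ 2 (+-cancelʳ-≤ (A + B + x) _ _ (begin
  2 * (tri A + B + x) + (A + B + x)         ≡⟨ regroupˡ (tri A) A B x ⟩
  (2 * tri A + A) + (3 * B + 3 * x)         ≡⟨ cong (_+ (3 * B + 3 * x)) (tri-double A) ⟩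
  A * A + (3 * B + 3 * x)                   ≤⟨ m≤m+n _ _ ⟩
  A * A + (3 * B + 3 * x) + slack           ≡⟨ squares α δ ⟩
  B * B + x * x + A                         ≡⟨ cong₂ (λ s t → s + t + A) (tri-double B) (tri-double x) ⟨
  (2 * tri B + B) + (2 * tri x + x) + A     ≡⟨ regroupʳ (tri B) (tri x) A B x ⟩
  2 * (tri B + tri x) + (A + B + x)         ∎))
  where
  open ≤-Reasoning
  A B : ℕ
  A = 2 + x + α
  B = 2 + x
  slack : ℕ
  slack = 7 * α * α + 25 * α + 20 + 6 * α * δ + 11 * δ + δ * δ
  regroupˡ : ∀ t A B x → 2 * (t + B + x) + (A + B + x) ≡ (2 * t + A) + (3 * B + 3 * x)
  regroupˡ = solve-∀
  regroupʳ : ∀ s t A B x → (2 * s + B) + (2 * t + x) + A ≡ 2 * (s + t) + (A + B + x)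
  regroupʳ = solve-∀
  squares : ∀ α δ → let x = 8 + 4 * α + δ ; A = 2 + x + α ; B = 2 + x in
    A * A + (3 * B + 3 * x) + (7 * α * α + 25 * α + 20 + 6 * α * δ + 11 * δ + δ * δ) ≡ B * B + x * x + A
  squares = solve-∀

Ascending : ∀ {n} → Fin n × Fin n → Set
Ascending p = proj₁ p F.< proj₂ p

bounded-injective⇒≤ : ∀ {r K} (c : Fin r → ℕ) → (∀ i → c i < K) → Injective _≡_ _≡_ c → r ≤ K
bounded-injective⇒≤ c c<K c-inj = FP.injective⇒≤ {f = λ i → fromℕ< (c<K i)} λ {i} {j} eq → c-inj (begin
  c i                    ≡⟨ FP.toℕ-fromℕ< (c<K i) ⟨
  toℕ (fromℕ< (c<K i))  ≡⟨ cong toℕ eq ⟩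
  toℕ (fromℕ< (c<K j))  ≡⟨ FP.toℕ-fromℕ< (c<K j) ⟩
  c j                    ∎)
  where open ≡-Reasoning

-- The pair u < v is the (tri v + u)-th ascending pair in colexicographic order.
rank : ∀ {n} → Fin n × Fin n → ℕ
rank (u , v) = tri (toℕ v) + toℕ u

tri+<tri : ∀ {u v w} → u < v → v < w → tri v + u < tri w
tri+<tri u<v v<w = <-≤-trans (+-monoʳ-< _ u<v) (tri-mono-≤ v<w)

rank<tri : ∀ {n} (p : Fin n × Fin n) → Ascending p → rank p < tri n
rank<tri (u , v) u<v = tri+<tri u<v (FP.toℕ<n v)

rank-injective : ∀ {n} {p q : Fin n × Fin n} → Ascending p → Ascending q → rank p ≡ rank q → p ≡ q
rank-injective {p = u , v} {u' , v'} u<v u'<v' eq with <-cmp (toℕ v) (toℕ v')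
... | tri< v<v' _ _ = ⊥-elim (<-irrefl eq (<-≤-trans (tri+<tri u<v v<v') (m≤m+n _ _)))
... | tri> _ _ v'<v = ⊥-elim (<-irrefl (sym eq) (<-≤-trans (tri+<tri u'<v' v'<v) (m≤m+n _ _)))
... | tri≈ _ v≡v' _ with FP.toℕ-injective v≡v'
... | refl = cong (_, v) (FP.toℕ-injective (+-cancelˡ-≡ (tri (toℕ v)) _ _ eq))

ascending-injection⇒≤tri : ∀ {r n} (f : Fin r → Fin n × Fin n) → (∀ i → Ascending (f i)) →
  Injective _≡_ _≡_ f → r ≤ tri n
ascending-injection⇒≤tri f asc f-inj = bounded-injective⇒≤ (rank ∘ f) (λ i → rank<tri (f i) (asc i))
  (λ eq → f-inj (rank-injective (asc _) (asc _) eq))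

unrank : ∀ n → Fin (tri n) → Fin n × Fin n
unrank-⊎ : ∀ n → Fin (tri n) ⊎ Fin n → Fin (suc n) × Fin (suc n)
unrank zero    ()
unrank (suc n) = unrank-⊎ n ∘ splitAt (tri n)
unrank-⊎ n (inj₁ r) = inject₁ (proj₁ (unrank n r)) , inject₁ (proj₂ (unrank n r))
unrank-⊎ n (inj₂ u) = inject₁ u , fromℕ n

unrank-ascending : ∀ n r → Ascending (unrank n r)
unrank-⊎-ascending : ∀ n s → Ascending (unrank-⊎ n s)
unrank-ascending (suc n) r = unrank-⊎-ascending n (splitAt (tri n) r)
unrank-⊎-ascending n (inj₁ r)
  rewrite FP.toℕ-inject₁ (proj₁ (unrank n r)) | FP.toℕ-inject₁ (proj₂ (unrank n r)) = unrank-ascending n r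
unrank-⊎-ascending n (inj₂ u) rewrite FP.toℕ-inject₁ u | FP.toℕ-fromℕ n = FP.toℕ<n u

unrank-injective : ∀ n → Injective _≡_ _≡_ (unrank n)
unrank-⊎-injective : ∀ n → Injective _≡_ _≡_ (unrank-⊎ n)
unrank-injective (suc n) {r} {s} eq = begin
  r                                   ≡⟨ FP.join-splitAt (tri n) n r ⟨
  join (tri n) n (splitAt (tri n) r)  ≡⟨ cong (join (tri n) n) (unrank-⊎-injective n eq) ⟩
  join (tri n) n (splitAt (tri n) s)  ≡⟨ FP.join-splitAt (tri n) n s ⟩
  s                                   ∎
  where open ≡-Reasoning
unrank-⊎-injective n {inj₁ r} {inj₁ s} eq = cong inj₁ (unrank-injective n
  (cong₂ _,_ (FP.inject₁-injective (cong proj₁ eq)) (FP.inject₁-injective (cong proj₂ eq))))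
unrank-⊎-injective n {inj₁ r} {inj₂ u} eq = ⊥-elim (FP.fromℕ≢inject₁ (sym (cong proj₂ eq)))
unrank-⊎-injective n {inj₂ u} {inj₁ s} eq = ⊥-elim (FP.fromℕ≢inject₁ (cong proj₂ eq))
unrank-⊎-injective n {inj₂ u} {inj₂ v} eq = cong inj₂ (FP.inject₁-injective (cong proj₁ eq))

ascending-code⇒tri≤ : ∀ {m K} (c : Fin m × Fin m → ℕ) → (∀ p → Ascending p → c p < K) →
  (∀ {p q} → Ascending p → Ascending q → c p ≡ c q → p ≡ q) → tri m ≤ K
ascending-code⇒tri≤ {m} c c<K c-inj = bounded-injective⇒≤ (c ∘ unrank m)
  (λ r → c<K _ (unrank-ascending m r))
  (λ eq → unrank-injective m (c-inj (unrank-ascending m _) (unrank-ascending m _) eq))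

weight-ordered-code⇒tri≤ : ∀ {m K} {w : Fin m → ℕ} → Injective _≡_ _≡_ w → (c : Fin m → Fin m → ℕ) →
  (∀ {i j} → w i < w j → c i j < K) →
  (∀ {i j k l} → w i < w j → w k < w l → c i j ≡ c k l → i ≡ k × j ≡ l) → tri m ≤ K
weight-ordered-code⇒tri≤ {m} {K} {w} w-inj c c<K c-inj =
  ascending-code⇒tri≤ (uncurry c ∘ orient) (λ p asc → c<K (orient-increasing p asc))
    (λ asc asc' eq → orient-injective asc asc'
      (uncurry (cong₂ _,_) (c-inj (orient-increasing _ asc) (orient-increasing _ asc') eq)))
  where
  orientᵈ : (p : Fin m × Fin m) → Dec (w (proj₁ p) < w (proj₂ p)) → Fin m × Fin m
  orientᵈ (i , j) (yes _) = i , j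
  orientᵈ (i , j) (no _)  = j , i

  weight<? : (p : Fin m × Fin m) → Dec (w (proj₁ p) < w (proj₂ p))
  weight<? (i , j) = w i <? w j

  orient : Fin m × Fin m → Fin m × Fin m
  orient p = orientᵈ p (weight<? p)

  orientᵈ-increasing : ∀ p d → Ascending p → w (proj₁ (orientᵈ p d)) < w (proj₂ (orientᵈ p d))
  orientᵈ-increasing (i , j) (yes wi<wj) _   = wi<wj
  orientᵈ-increasing (i , j) (no wi≮wj)  i<j =
    ≤∧≢⇒< (≮⇒≥ wi≮wj) (λ eq → <-irrefl (cong toℕ (w-inj (sym eq))) i<j)

  orient-increasing : ∀ p → Ascending p → w (proj₁ (orient p)) < w (proj₂ (orient p))
  orient-increasing p = orientᵈ-increasing p (weight<? p)

  orientᵈ-injective : ∀ {p q} d d' → Ascending p → Ascending q → orientᵈ p d ≡ orientᵈ q d' → p ≡ q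
  orientᵈ-injective (yes _) (yes _) _   _   eq   = eq
  orientᵈ-injective (no _)  (no _)  _   _   eq   = cong₂ _,_ (cong proj₂ eq) (cong proj₁ eq)
  orientᵈ-injective (yes _) (no _)  i<j j<i refl = ⊥-elim (<-asym i<j j<i)
  orientᵈ-injective (no _)  (yes _) j<i i<j refl = ⊥-elim (<-asym i<j j<i)

  orient-injective : ∀ {p q} → Ascending p → Ascending q → orient p ≡ orient q → p ≡ q
  orient-injective {p} {q} = orientᵈ-injective (weight<? p) (weight<? q)

-- Sidon weightings

Sidon : ∀ {m} → (Fin m → ℕ) → Set
Sidon w = ∀ {i j k l} → i ≢ j → k ≢ l → w i + w j ≡ w k + w l → (i ≡ k × j ≡ l) ⊎ (i ≡ l × j ≡ k)

sidon-∘-injective : ∀ {m r} {w : Fin m → ℕ} {ρ : Fin r → Fin m} → Sidon w → Injective _≡_ _≡_ ρ →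
  Sidon (w ∘ ρ)
sidon-∘-injective sidon ρ-inj i≢j k≢l eq with sidon (i≢j ∘ ρ-inj) (k≢l ∘ ρ-inj) eq
... | inj₁ (i≡k , j≡l) = inj₁ (ρ-inj i≡k , ρ-inj j≡l)
... | inj₂ (i≡l , j≡k) = inj₂ (ρ-inj i≡l , ρ-inj j≡k)

Middle : ∀ {m} → (Fin m → ℕ) → Fin m → Fin m → Set
Middle w i j = ∃ λ k → w k + w j ≡ w i + w i

<-mean : ∀ {a b c} → a + b ≡ c + c → c < b → a < c
<-mean {a} {b} {c} eq c<b with a <? c
... | yes a<c = a<c
... | no  a≮c = ⊥-elim (<-irrefl (sym eq) (+-mono-≤-< (≮⇒≥ a≮c) c<b))

sidon-middle-unique : ∀ {m} {w : Fin m → ℕ} → Sidon w → ∀ {i j j'} → w i < w j → w i < w j' →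
  Middle w i j → Middle w i j' → j ≡ j'
sidon-middle-unique {w = w} sidon {i} {j} {j'} wi<wj wi<wj' (k , mid) (k' , mid') =
  resolve (sidon (apart mid wi<wj) (apart mid' wi<wj') (trans mid (sym mid')))
  where
  apart : ∀ {k j} → w k + w j ≡ w i + w i → w i < w j → k ≢ j
  apart mid wi<wj refl = <-asym (<-mean mid wi<wj) wi<wj
  resolve : (k ≡ k' × j ≡ j') ⊎ (k ≡ j' × j ≡ k') → j ≡ j'
  resolve (inj₁ (_ , j≡j'))    = j≡j'
  resolve (inj₂ (refl , refl)) = ⊥-elim (<-asym (<-mean mid' wi<wj') wi<wj)

sidon-difference-injective : ∀ {m} {w : Fin m → ℕ} → Sidon w → ∀ {i j k l} → w i < w j → w k < w l →
  ¬ Middle w i j → ¬ Middle w k l → w j + w k ≡ w l + w i → i ≡ k × j ≡ l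
sidon-difference-injective {w = w} sidon {i} {j} {k} {l} wi<wj wk<wl ¬mid ¬mid' eq
  with j FP.≟ k | l FP.≟ i
... | yes refl | _        = ⊥-elim (¬mid' (i , trans (+-comm (w i) (w l)) (sym eq)))
... | no _     | yes refl = ⊥-elim (¬mid (k , trans (+-comm (w k) (w j)) eq))
... | no j≢k   | no l≢i with sidon j≢k l≢i eq
...   | inj₁ (j≡l , k≡i) = sym k≡i , j≡l
...   | inj₂ (refl , _)  = ⊥-elim (<-irrefl refl wi<wj)

∸-suc-injective : ∀ {a b x y} → a < x → b < y → x ∸ suc a ≡ y ∸ suc b → x + b ≡ y + a
∸-suc-injective {a} {b} {x} {y} a<x b<y eq = suc-injective (begin
  suc (x + b)                  ≡⟨ +-suc x b ⟨
  x + suc b                    ≡⟨ cong (_+ suc b) (m∸n+n≡m a<x) ⟨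
  x ∸ suc a + suc a + suc b    ≡⟨ cong (λ t → t + suc a + suc b) eq ⟩
  y ∸ suc b + suc a + suc b    ≡⟨ +-assoc (y ∸ suc b) (suc a) (suc b) ⟩
  y ∸ suc b + (suc a + suc b)  ≡⟨ cong (y ∸ suc b +_) (+-comm (suc a) (suc b)) ⟩
  y ∸ suc b + (suc b + suc a)  ≡⟨ +-assoc (y ∸ suc b) (suc b) (suc a) ⟨
  y ∸ suc b + suc b + suc a    ≡⟨ cong (_+ suc a) (m∸n+n≡m b<y) ⟩
  y + suc a                    ≡⟨ +-suc y a ⟩
  suc (y + a)                  ∎)
  where open ≡-Reasoning

∸-suc-< : ∀ {lo a b hi} → lo ≤ a → a < b → b ≤ hi → b ∸ suc a < hi ∸ lo
∸-suc-< {a = a} lo≤a a<b b≤hi = ≤-<-trans (∸-monoˡ-≤ (suc a) b≤hi) (∸-monoʳ-< (s≤s lo≤a) (≤-trans a<b b≤hi))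

-- A pair is coded by its gap w j − w i − 1 < D, or by D + i when i is the middle of a
-- progression ending at j.
sidon-spread : ∀ {m lo hi} {w : Fin m → ℕ} → Injective _≡_ _≡_ w → Sidon w →
  (∀ i → lo ≤ w i) → (∀ i → w i ≤ hi) → tri m ≤ (hi ∸ lo) + m
sidon-spread {m} {lo} {hi} {w} w-inj sidon lo≤w w≤hi =
  weight-ordered-code⇒tri≤ w-inj code (codeᵈ< (middle? _ _)) (codeᵈ-injective (middle? _ _) (middle? _ _))
  where
  D : ℕ
  D = hi ∸ lo

  middle? : ∀ i j → Dec (Middle w i j)
  middle? i j = FP.any? λ k → w k + w j ≟ w i + w i

  codeᵈ : ∀ {i j} → Dec (Middle w i j) → ℕ
  codeᵈ {i}     (yes _) = D + toℕ i
  codeᵈ {i} {j} (no _)  = w j ∸ suc (w i)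

  code : Fin m → Fin m → ℕ
  code i j = codeᵈ (middle? i j)

  gap<D : ∀ {i j} → w i < w j → w j ∸ suc (w i) < D
  gap<D wi<wj = ∸-suc-< (lo≤w _) wi<wj (w≤hi _)

  codeᵈ< : ∀ {i j} (d : Dec (Middle w i j)) → w i < w j → codeᵈ d < D + m
  codeᵈ< {i} (yes _) _     = +-monoʳ-< D (FP.toℕ<n i)
  codeᵈ<     (no _)  wi<wj = <-≤-trans (gap<D wi<wj) (m≤m+n D m)

  codeᵈ-injective : ∀ {i j k l} (d : Dec (Middle w i j)) (d' : Dec (Middle w k l)) →
    w i < w j → w k < w l → codeᵈ d ≡ codeᵈ d' → i ≡ k × j ≡ l
  codeᵈ-injective (yes mid) (yes mid') wi<wj wk<wl eq with FP.toℕ-injective (+-cancelˡ-≡ D _ _ eq)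
  ... | refl = refl , sidon-middle-unique sidon wi<wj wk<wl mid mid'
  codeᵈ-injective (yes _) (no _) _ wk<wl eq =
    ⊥-elim (<-irrefl (sym eq) (<-≤-trans (gap<D wk<wl) (m≤m+n D _)))
  codeᵈ-injective (no _) (yes _) wi<wj _ eq =
    ⊥-elim (<-irrefl eq (<-≤-trans (gap<D wi<wj) (m≤m+n D _)))
  codeᵈ-injective (no ¬mid) (no ¬mid') wi<wj wk<wl eq =
    sidon-difference-injective sidon wi<wj wk<wl ¬mid ¬mid' (∸-suc-injective wi<wj wk<wl eq)

arg-extremum : ∀ {m} {A : Set} {_≼_ : A → A → Set} → Reflexive _≼_ → Transitive _≼_ → Total _≼_ →
  (w : Fin (suc m) → A) → Σ (Fin (suc m)) λ a → ∀ i → w a ≼ w i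
arg-extremum {zero}  ≼-refl _       _       w = zero , λ { zero → ≼-refl }
arg-extremum {suc m} ≼-refl ≼-trans ≼-total w with arg-extremum ≼-refl ≼-trans ≼-total (w ∘ suc)
... | a , a≼ with ≼-total (w zero) (w (suc a))
...   | inj₁ 0≼a = zero  , λ { zero → ≼-refl ; (suc i) → ≼-trans 0≼a (a≼ i) }
...   | inj₂ a≼0 = suc a , λ { zero → a≼0    ; (suc i) → a≼ i }

argmin : ∀ {m} (w : Fin (suc m) → ℕ) → Σ (Fin (suc m)) λ a → ∀ i → w a ≤ w i
argmin = arg-extremum ≤-refl ≤-trans ≤-total

argmax : ∀ {m} (w : Fin (suc m) → ℕ) → Σ (Fin (suc m)) λ z → ∀ i → w i ≤ w z
argmax = arg-extremum {_≼_ = _≥_} ≤-refl (flip ≤-trans) (flip ≤-total)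

min≢max : ∀ {x} {w : Fin (2 + x) → ℕ} → Injective _≡_ _≡_ w → ∀ {a z} →
  (∀ i → w a ≤ w i) → (∀ i → w i ≤ w z) → a ≢ z
min≢max w-inj min max refl with w-inj (≤-antisym (≤-trans (max zero) (min (suc zero)))
                                                  (≤-trans (max (suc zero)) (min zero)))
... | ()

skip₂ : ∀ {x} {a z : Fin (2 + x)} → a ≢ z → Fin x → Fin (2 + x)
skip₂ {a = a} a≢z t = punchIn a (punchIn (punchOut a≢z) t)

skip₂-injective : ∀ {x} {a z : Fin (2 + x)} (a≢z : a ≢ z) → Injective _≡_ _≡_ (skip₂ a≢z)
skip₂-injective {a = a} a≢z eq = FP.punchIn-injective _ _ _ (FP.punchIn-injective a _ _ eq)

skip₂-≢ˡ : ∀ {x} {a z : Fin (2 + x)} (a≢z : a ≢ z) t → skip₂ a≢z t ≢ a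
skip₂-≢ˡ {a = a} _ t = FP.punchInᵢ≢i a _

skip₂-≢ʳ : ∀ {x} {a z : Fin (2 + x)} (a≢z : a ≢ z) t → skip₂ a≢z t ≢ z
skip₂-≢ʳ {a = a} a≢z t eq = FP.punchInᵢ≢i (punchOut a≢z) t
  (FP.punchIn-injective a _ _ (trans eq (sym (FP.punchIn-punchOut a≢z))))

∸+∸< : ∀ {a b c d q} → c ≤ a → d ≤ b → a + b < c + d + q → (a ∸ c) + (b ∸ d) < q
∸+∸< {a} {b} {c} {d} {q} c≤a d≤b ab<cdq = +-cancelʳ-< (c + d) _ q (begin-strict
  (a ∸ c) + (b ∸ d) + (c + d)  ≡⟨ +-comm-middle (a ∸ c) (b ∸ d) c d ⟩
  (a ∸ c + c) + (b ∸ d + d)    ≡⟨ cong₂ _+_ (m∸n+n≡m c≤a) (m∸n+n≡m d≤b) ⟩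
  a + b                        <⟨ ab<cdq ⟩
  c + d + q                    ≡⟨ +-comm (c + d) q ⟩
  q + (c + d)                  ∎)
  where
  open ≤-Reasoning
  +-comm-middle : ∀ p r s t → p + r + (s + t) ≡ (p + s) + (r + t)
  +-comm-middle = solve-∀

-- Remove the extreme points a and z and take the extremes b and y of the rest: the pair sums
-- w z + w y and w a + w b differ by less than q, so the two diameters sum to less than q.
sidon-two-layer : ∀ {x q} {w : Fin (2 + x) → ℕ} → Injective _≡_ _≡_ w → Sidon w →
  (∀ {i j k l} → i ≢ j → k ≢ l → w i + w j < w k + w l + q) →
  tri (2 + x) + tri x < q + (2 + x) + x
sidon-two-layer {zero} {q} _ _ _ = ≤-trans (m≤n+m 2 q) (m≤m+n (q + 2) 0)
sidon-two-layer {x@(suc _)} {q} {w} w-inj sidon window = begin-strict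
  tri (2 + x) + tri x                     ≤⟨ +-mono-≤ outer inner ⟩
  (D₁ + (2 + x)) + (D₂ + x)               ≡⟨ regroup D₁ (2 + x) D₂ x ⟩
  (D₁ + D₂) + (2 + x) + x                 <⟨ +-monoˡ-< x (+-monoˡ-< (2 + x) diameters) ⟩
  q + (2 + x) + x                         ∎
  where
  open ≤-Reasoning
  regroup : ∀ p r s t → p + r + (s + t) ≡ p + s + r + t
  regroup = solve-∀

  a z : Fin (2 + x)
  a = proj₁ (argmin w)
  z = proj₁ (argmax w)
  a≢z : a ≢ z
  a≢z = min≢max w-inj (proj₂ (argmin w)) (proj₂ (argmax w))
  v : Fin x → ℕ
  v = w ∘ skip₂ a≢z
  b y : Fin x
  b = proj₁ (argmin v)
  y = proj₁ (argmax v)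
  D₁ D₂ : ℕ
  D₁ = w z ∸ w a
  D₂ = v y ∸ v b

  outer : tri (2 + x) ≤ D₁ + (2 + x)
  outer = sidon-spread w-inj sidon (proj₂ (argmin w)) (proj₂ (argmax w))
  inner : tri x ≤ D₂ + x
  inner = sidon-spread (λ eq → skip₂-injective a≢z (w-inj eq))
                       (sidon-∘-injective {w = w} sidon (skip₂-injective a≢z))
                       (proj₂ (argmin v)) (proj₂ (argmax v))
  diameters : D₁ + D₂ < q
  diameters = ∸+∸< (proj₂ (argmin w) z) (proj₂ (argmin v) y)
    (window (skip₂-≢ʳ a≢z y ∘ sym) (skip₂-≢ˡ a≢z b ∘ sym))

-- Cliques in graphs with few non-edges

NonEdgeFamily : ∀ {n} → ℕ → (Fin n → Fin n → Set) → Set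
NonEdgeFamily {n} k Adj = Σ (Fin k → Fin n × Fin n) λ f →
  Injective _≡_ _≡_ f × (∀ i → Ascending (f i) × ¬ uncurry Adj (f i))

IsClique : ∀ {m n} → (Fin n → Fin n → Set) → (Fin m → Fin n) → Set
IsClique Adj h = Injective _≡_ _≡_ h × (∀ i j → h i F.< h j → Adj (h i) (h j))

punchIn-mono-< : ∀ {n} (u : Fin (suc n)) {x y : Fin n} → x F.< y → punchIn u x F.< punchIn u y
punchIn-mono-< u {x} {y} x<y = ≤∧≢⇒< (FP.punchIn-mono-≤ u x y (<⇒≤ x<y))
  (λ eq → <-irrefl (cong toℕ (FP.punchIn-injective u x y (FP.toℕ-injective eq))) x<y)

punchIn-cancel-< : ∀ {n} (u : Fin (suc n)) {x y : Fin n} → punchIn u x F.< punchIn u y → x F.< y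
punchIn-cancel-< u {x} {y} ux<uy = ≤∧≢⇒< (FP.punchIn-cancel-≤ u x y (<⇒≤ ux<uy))
  (λ eq → <-irrefl (cong (toℕ ∘ punchIn u) (FP.toℕ-injective eq)) ux<uy)

nonEdgeFamily-punchIn : ∀ {k n} {Adj : Fin (suc n) → Fin (suc n) → Set} {u v} → u F.< v → ¬ Adj u v →
  NonEdgeFamily k (λ x y → Adj (punchIn u x) (punchIn u y)) → NonEdgeFamily (suc k) Adj
nonEdgeFamily-punchIn {k} {n} {Adj} {u} {v} u<v ¬uv (f , f-inj , f-non) = g , g-inj , g-non
  where
  g : Fin (suc k) → Fin (suc n) × Fin (suc n)
  g zero    = u , v
  g (suc i) = punchIn u (proj₁ (f i)) , punchIn u (proj₂ (f i))
  g-inj : Injective _≡_ _≡_ g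
  g-inj {zero}  {zero}  _  = refl
  g-inj {zero}  {suc j} eq = ⊥-elim (FP.punchInᵢ≢i u _ (sym (cong proj₁ eq)))
  g-inj {suc i} {zero}  eq = ⊥-elim (FP.punchInᵢ≢i u _ (cong proj₁ eq))
  g-inj {suc i} {suc j} eq = cong suc (f-inj (cong₂ _,_ (FP.punchIn-injective u _ _ (cong proj₁ eq))
                                                        (FP.punchIn-injective u _ _ (cong proj₂ eq))))
  g-non : ∀ i → Ascending (g i) × ¬ uncurry Adj (g i)
  g-non zero    = u<v , ¬uv
  g-non (suc i) = punchIn-mono-< u (proj₁ (f-non i)) , proj₂ (f-non i)

-- Deleting an endpoint u of a non-edge uv loses that non-edge, which drives the induction on α.
large-clique : ∀ α {n} (Adj : Fin n → Fin n → Set) → (∀ u v → Dec (Adj u v)) →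
  ¬ NonEdgeFamily (suc α) Adj → ∃ λ m → n ≤ m + α × Σ (Fin m → Fin n) (IsClique Adj)
large-clique α {n} Adj adj? few with FP.any? (λ u → FP.any? (λ v → (toℕ u <? toℕ v) ×-dec ¬? (adj? u v)))
... | no no-non-edge = n , m≤m+n n α , (λ u → u) , (λ eq → eq) ,
  λ u v u<v → decidable-stable (adj? u v) (λ ¬uv → no-non-edge (u , v , u<v , ¬uv))
large-clique zero Adj adj? few | yes (u , v , u<v , ¬uv) =
  ⊥-elim (few ((λ _ → u , v) , (λ { {zero} {zero} _ → refl }) , λ _ → u<v , ¬uv))
large-clique (suc α) {suc n} Adj adj? few | yes (u , v , u<v , ¬uv)
  with large-clique α (λ x y → Adj (punchIn u x) (punchIn u y)) (λ x y → adj? (punchIn u x) (punchIn u y))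
                      (few ∘ nonEdgeFamily-punchIn u<v ¬uv)
... | m , n≤m+α , h , h-inj , h-clique =
  m , subst (suc n ≤_) (sym (+-suc m α)) (s≤s n≤m+α) , punchIn u ∘ h ,
  (λ eq → h-inj (FP.punchIn-injective u _ _ eq)) ,
  (λ i j ui<uj → h-clique i j (punchIn-cancel-< u ui<uj))

-- Super edge-magic labellings of dense graphs

Adjacent : ∀ {n} → Graph n → Fin n → Fin n → Set
Adjacent G u v = ∃ λ e → edge G e ≡ (u , v)

adjacent? : ∀ {n} (G : Graph n) u v → Dec (Adjacent G u v)
adjacent? G u v = FP.any? λ e → ≡-dec FP._≟_ FP._≟_ (edge G e) (u , v)

size≤tri : ∀ {n} (G : Graph n) → size G ≤ tri n
size≤tri G = ascending-injection⇒≤tri (edge G) (edge< G) (edge-inj G)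

splitAt-[,]-injective : ∀ {A : Set} {r s} {f : Fin r → A} {g : Fin s → A} →
  Injective _≡_ _≡_ f → Injective _≡_ _≡_ g → (∀ i j → f i ≢ g j) →
  Injective _≡_ _≡_ ([ f , g ] ∘ splitAt r)
splitAt-[,]-injective {r = r} {s} {f} {g} f-inj g-inj f≢g {x} {y} eq = begin
  x                       ≡⟨ FP.join-splitAt r s x ⟨
  join r s (splitAt r x)  ≡⟨ cong (join r s) (split-injective (splitAt r x) (splitAt r y) eq) ⟩
  join r s (splitAt r y)  ≡⟨ FP.join-splitAt r s y ⟩
  y                       ∎
  where
  open ≡-Reasoning
  split-injective : ∀ p q → [ f , g ] p ≡ [ f , g ] q → p ≡ q
  split-injective (inj₁ i) (inj₁ j) eq = cong inj₁ (f-inj eq)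
  split-injective (inj₁ i) (inj₂ j) eq = ⊥-elim (f≢g i j eq)
  split-injective (inj₂ i) (inj₁ j) eq = ⊥-elim (f≢g j i (sym eq))
  split-injective (inj₂ i) (inj₂ j) eq = cong inj₂ (g-inj eq)

dense⇒¬nonEdgeFamily : ∀ {n α} (G : Graph n) → tri n ≤ size G + α →
  ¬ NonEdgeFamily (suc α) (Adjacent G)
dense⇒¬nonEdgeFamily {n} {α} G dense (f , f-inj , f-non) = <-irrefl refl (begin-strict
  size G + α      <⟨ +-monoʳ-< (size G) ≤-refl ⟩
  size G + suc α  ≤⟨ ascending-injection⇒≤tri (pairs ∘ splitAt (size G)) (ascending ∘ splitAt (size G))
                       (splitAt-[,]-injective (edge-inj G) f-inj λ e i eq → proj₂ (f-non i) (e , eq)) ⟩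
  tri n           ≤⟨ dense ⟩
  size G + α      ∎)
  where
  open ≤-Reasoning
  pairs : Fin (size G) ⊎ Fin (suc α) → Fin n × Fin n
  pairs = [ edge G , f ]
  ascending : ∀ s → Ascending (pairs s)
  ascending (inj₁ e) = edge< G e
  ascending (inj₂ i) = proj₁ (f-non i)

Joins : ∀ {n} → Fin n × Fin n → Fin n → Fin n → Set
Joins p u v = p ≡ (u , v) ⊎ p ≡ (v , u)

joins-unique : ∀ {n} {p : Fin n × Fin n} {u v u' v'} → Joins p u v → Joins p u' v' →
  (u ≡ u' × v ≡ v') ⊎ (u ≡ v' × v ≡ u')
joins-unique (inj₁ refl) (inj₁ refl) = inj₁ (refl , refl)
joins-unique (inj₁ refl) (inj₂ refl) = inj₂ (refl , refl)
joins-unique (inj₂ refl) (inj₁ refl) = inj₂ (refl , refl)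
joins-unique (inj₂ refl) (inj₂ refl) = inj₁ (refl , refl)

clique-edge : ∀ {m n} (G : Graph n) {h : Fin m → Fin n} → IsClique (Adjacent G) h →
  ∀ {i j} → i ≢ j → ∃ λ e → Joins (edge G e) (h i) (h j)
clique-edge G {h} (h-inj , h-clique) {i} {j} i≢j with <-cmp (toℕ (h i)) (toℕ (h j))
... | tri< hi<hj _ _ = let e , eq = h-clique i j hi<hj in e , inj₁ eq
... | tri≈ _ hi≡hj _ = ⊥-elim (i≢j (h-inj (FP.toℕ-injective hi≡hj)))
... | tri> _ _ hj<hi = let e , eq = h-clique j i hj<hi in e , inj₂ eq

edgeSum : ∀ {n} (G : Graph n) → (Fin n → ℕ) → Fin (size G) → ℕ
edgeSum G w e = w (proj₁ (edge G e)) + w (proj₂ (edge G e))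

-- The edge sums c − f(e) of a super edge-magic labelling are distinct and fill a window of width q.
record SumLabelling {n} (G : Graph n) : Set where
  field
    weight            : Fin n → ℕ
    weight-injective  : Injective _≡_ _≡_ weight
    edgeSum-injective : Injective _≡_ _≡_ (edgeSum G weight)
    edgeSum-window    : ∀ e f → edgeSum G weight e < edgeSum G weight f + size G

superEdgeMagic⇒sumLabelling : ∀ {n k} (G : Graph n) → SuperEdgeMagic (addIsolated k G) → SumLabelling G
superEdgeMagic⇒sumLabelling {n} {k} G (fv , (fv-inj , _) , fe , (fe-inj , _) , c , magic) = record
  { weight            = weight
  ; weight-injective  = λ eq → FP.↑ˡ-injective k _ _ (fv-inj (FP.toℕ-injective eq))
  ; edgeSum-injective = λ {e} {f} eq → fe-inj (FP.toℕ-injective (+-cancelˡ-≡ (edgeSum G weight e) _ _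
                          (trans (sum+label-constant e f) (cong (_+ label f) (sym eq)))))
  ; edgeSum-window    = λ e f → begin-strict
      edgeSum G weight e               ≤⟨ m≤m+n _ (label e) ⟩
      edgeSum G weight e + label e     ≡⟨ sum+label-constant e f ⟩
      edgeSum G weight f + label f     <⟨ +-monoʳ-< _ (FP.toℕ<n (fe f)) ⟩
      edgeSum G weight f + size G      ∎
  }
  where
  open ≤-Reasoning
  weight : Fin n → ℕ
  weight x = toℕ (fv (x ↑ˡ k))
  label : Fin (size G) → ℕ
  label e = toℕ (fe e)
  shift : ∀ a b l p → suc a + suc b + (p + suc l) ≡ (a + b + l) + (p + 3)
  shift = solve-∀
  magic-sum : ∀ e → edgeSum G weight e + label e + (n + k + 3) ≡ c
  magic-sum e = trans (sym (shift (weight (proj₁ (edge G e))) (weight (proj₂ (edge G e))) (label e) (n + k)))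
                      (magic e)
  sum+label-constant : ∀ e f → edgeSum G weight e + label e ≡ edgeSum G weight f + label f
  sum+label-constant e f = +-cancelʳ-≡ (n + k + 3) _ _ (trans (magic-sum e) (sym (magic-sum f)))

module _ {n} {G : Graph n} (L : SumLabelling G) {m} {h : Fin m → Fin n}
         (h-clique : IsClique (Adjacent G) h) where
  open SumLabelling L

  joins-edgeSum : ∀ e {u v} → Joins (edge G e) u v → edgeSum G weight e ≡ weight u + weight v
  joins-edgeSum e (inj₁ eq) = cong (λ p → weight (proj₁ p) + weight (proj₂ p)) eq
  joins-edgeSum e {u} {v} (inj₂ eq) =
    trans (cong (λ p → weight (proj₁ p) + weight (proj₂ p)) eq) (+-comm (weight v) (weight u))

  clique-weight-injective : Injective _≡_ _≡_ (weight ∘ h)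
  clique-weight-injective eq = proj₁ h-clique (weight-injective eq)

  clique-weight-sidon : Sidon (weight ∘ h)
  clique-weight-sidon i≢j k≢l eq
    with clique-edge G h-clique i≢j | clique-edge G h-clique k≢l
  ... | e , e-joins | f , f-joins
    with edgeSum-injective (trans (joins-edgeSum e e-joins) (trans eq (sym (joins-edgeSum f f-joins))))
  ... | refl with joins-unique e-joins f-joins
  ...   | inj₁ (i≡k , j≡l) = inj₁ (proj₁ h-clique i≡k , proj₁ h-clique j≡l)
  ...   | inj₂ (i≡l , j≡k) = inj₂ (proj₁ h-clique i≡l , proj₁ h-clique j≡k)

  clique-weight-window : ∀ {i j k l} → i ≢ j → k ≢ l →
    weight (h i) + weight (h j) < weight (h k) + weight (h l) + size G
  clique-weight-window i≢j k≢l with clique-edge G h-clique i≢j | clique-edge G h-clique k≢l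
  ... | e , e-joins | f , f-joins =
    subst₂ (λ s t → s < t + size G) (joins-edgeSum e e-joins) (joins-edgeSum f f-joins) (edgeSum-window e f)

clique-order : ∀ {α n m} → 10 + 5 * α ≤ n → n ≤ m + α → 10 + 4 * α ≤ m
clique-order {α} {n} {m} n-large n≤m+α = +-cancelʳ-≤ α _ _ (begin
  10 + 4 * α + α  ≡⟨ regroup α ⟩
  10 + 5 * α      ≤⟨ n-large ⟩
  n               ≤⟨ n≤m+α ⟩
  m + α           ∎)
  where
  open ≤-Reasoning
  regroup : ∀ α → 10 + 4 * α + α ≡ 10 + 5 * α
  regroup = solve-∀

dense-¬sumLabelling : ∀ {n α} (G : Graph n) → 10 + 5 * α ≤ n → tri n ≤ size G + α → ¬ SumLabelling G
dense-¬sumLabelling {n} {α} G n-large dense L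
  with large-clique α (Adjacent G) (adjacent? G) (dense⇒¬nonEdgeFamily G dense)
... | m , n≤m+α , h , h-clique with clique-order {α} {n} {m} n-large n≤m+α
... | s≤s (s≤s {n = x} x-large) = <-irrefl refl (begin-strict
  tri (2 + x) + tri x            <⟨ sidon-two-layer (clique-weight-injective L h-clique)
                                      (clique-weight-sidon L h-clique) (clique-weight-window L h-clique) ⟩
  size G + (2 + x) + x           ≤⟨ +-monoˡ-≤ x (+-monoˡ-≤ (2 + x) (size≤tri G)) ⟩
  tri n + (2 + x) + x            ≤⟨ +-monoˡ-≤ x (+-monoˡ-≤ (2 + x) (tri-mono-≤ n≤m+α)) ⟩
  tri (2 + x + α) + (2 + x) + x  ≤⟨ tri-gap x-large ⟩
  tri (2 + x) + tri x            ∎)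
  where open ≤-Reasoning

α<tri : ∀ {α n} → 10 + 5 * α ≤ n → α < tri n
α<tri {α} {suc n} (s≤s n-large) = begin-strict
  α                  <⟨ s≤s (m≤m+n α (4 * α)) ⟩
  suc (α + 4 * α)    ≤⟨ m≤n+m _ 8 ⟩
  9 + 5 * α          ≤⟨ n-large ⟩
  n                  ≤⟨ m≤n+m n (tri n) ⟩
  tri n + n          ∎
  where open ≤-Reasoning

-- The bound 10 + 5α works for every α.
mainTheorem5 : ∀ (α : ℕ) → 1 ≤ α →
    ∃ λ N → ∀ n → N ≤ n → ∀ l → IsL n l → l ≤ (n C 2) ∸ α
mainTheorem5 α _ = 10 + 5 * α , λ n n-large l (_ , _ , l-minimal) →
  l-minimal ((n C 2) ∸ α) (m<n⇒0<n∸m (subst (α <_) (tri≡nC2 n) (α<tri n-large)))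
    λ G large k sem → dense-¬sumLabelling G n-large (dense n G large) (superEdgeMagic⇒sumLabelling G sem)
  where
  dense : ∀ n (G : Graph n) → (n C 2) ∸ α ≤ size G → tri n ≤ size G + α
  dense n G large = begin
    tri n              ≡⟨ tri≡nC2 n ⟩
    n C 2              ≤⟨ m≤n+m∸n (n C 2) α ⟩
    α + ((n C 2) ∸ α)  ≤⟨ +-monoʳ-≤ α large ⟩
    α + size G         ≡⟨ +-comm α (size G) ⟩
    size G + α         ∎
    where open ≤-Reasoning
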